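{- Let $D$ be a super edge-magic labeled digraph of order and size equal to $p$, whose vertices are named by their labels. Let $\mathcal{S}_n^k$ be the set of all super edge-magic labeled (simple) digraphs with order and size equal to $n$ and magic sum $k$, each vertex named by its label. Define $D_1=D$ and, for each $i\ge1$, $D_{i+1}=D_i\otimes_{h_i}\mathcal{S}_n^k$, where $h_i:E(D_i)\to\mathcal{S}_n^k$ are arbitrary functions. Then, for every $i\ge1$, $D_i$ admits at least $i+1$ edge-magic labelings with $i+1$ distinct magic sums.
   Context: All graphs are simple; labelings of digraphs are labelings of their underlying graphs. For a graph with $p$ vertices and $q$ edges, an edge-magic labeling is a bijection $f:V\cup E\to\{1,\dots,p+q\}$ such that $f(x)+f(xy)+f(y)$ is constant (the magic sum) over all edges $xy$; it is super edge-magic if also $f(V)=\{1,\dots,p\}$. Product: for a digraph $D$, a family $\Gamma$ of digraphs with common vertex set $V$ (here $\{1,\dots,n\}$) and $h:E(D)\to\Gamma$, $D\otimes_h\Gamma$ has vertex set $V(D)\times V$ and $((a,x),(b,y))$ is an arc iff $(a,b)\in E(D)$ and $(x,y)\in E(h(a,b))$. -}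

module Defs where

open import Data.Nat using (ℕ; zero; suc; _+_; _≤_)
open import Data.Fin using (Fin; toℕ)
open import Data.Bool using (Bool; true; false; T)
open import Data.Unit using (tt)
open import Data.Product using (Σ; ∃; ∃₂; _×_; _,_; proj₁; proj₂)
open import Data.Sum using (_⊎_; inj₁; inj₂)
open import Function.Bundles using (_↔_)
open import Function.Definitions using (Injective)
open import Relation.Binary.PropositionalEquality using (_≡_)

record Digraph : Set₁ where
  constructor digraph
  field
    V   : Set
    arc : V → V → Bool
open Digraph public

E : Digraph → Set
E G = Σ (V G × V G) λ xy → T (arc G (proj₁ xy) (proj₂ xy))

tail head : (G : Digraph) → E G → V G
tail G e = proj₁ (proj₁ e)
head G e = proj₂ (proj₁ e)

-- Simple digraph whose underlying graph is simple: no loops, no pair of opposite arcs.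
Oriented : Digraph → Set
Oriented G = (∀ x → arc G x x ≡ false)
           × (∀ x y → arc G x y ≡ true → arc G y x ≡ false)

HasOrder : Digraph → ℕ → Set
HasOrder G p = V G ↔ Fin p

HasSize : Digraph → ℕ → Set
HasSize G q = E G ↔ Fin q

Labeling : Digraph → Set
Labeling G = V G ⊎ E G → ℕ

BijOnto : {A : Set} → (A → ℕ) → ℕ → Set
BijOnto {A} f N = (∀ z → 1 ≤ f z × f z ≤ N)
                × Injective _≡_ _≡_ f
                × (∀ m → 1 ≤ m → m ≤ N → ∃ λ z → f z ≡ m)

Magic : (G : Digraph) → Labeling G → ℕ → Set
Magic G f k = ∀ (e : E G) → f (inj₁ (tail G e)) + f (inj₂ e) + f (inj₁ (head G e)) ≡ k

IsEdgeMagic : (G : Digraph) → Labeling G → ℕ → Set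
IsEdgeMagic G f k = ∃₂ λ p q → HasOrder G p × HasSize G q
                  × BijOnto f (p + q) × Magic G f k

IsSuperEdgeMagic : (G : Digraph) → Labeling G → ℕ → Set
IsSuperEdgeMagic G f k = ∃₂ λ p q → HasOrder G p × HasSize G q
                       × BijOnto f (p + q) × (∀ x → f (inj₁ x) ≤ p) × Magic G f k

-- A super edge-magic labeled simple digraph on vertex set {1,...,m} (encoded as Fin m,
-- vertex x named toℕ x + 1) with size q and magic sum k, each vertex named by its label.
NamedSEM : (m q k : ℕ) → (Fin m → Fin m → Bool) → Set
NamedSEM m q k r = Oriented (digraph (Fin m) r) × HasSize (digraph (Fin m) r) q
                 × Σ (Labeling (digraph (Fin m) r)) λ f →
                     IsSuperEdgeMagic (digraph (Fin m) r) f k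
                     × (∀ x → f (inj₁ x) ≡ suc (toℕ x))

S : ℕ → ℕ → Set
S n k = Σ (Fin n → Fin n → Bool) (NamedSEM n n k)

sel : (b : Bool) → (T b → Bool) → Bool
sel true  g = g tt
sel false g = false

prod : (D : Digraph) {n k : ℕ} → (E D → S n k) → Digraph
prod D {n} h = digraph (V D × Fin n) λ { (a , x) (b , y) →
  sel (arc D a b) (λ t → proj₁ (h ((a , b) , t)) x y) }

-- Iter D n k i G : G is D_i for some choice of h_1, ..., h_{i-1}.
data Iter (D : Digraph) (n k : ℕ) : ℕ → Digraph → Set₁ where
  base : Iter D n k 1 D
  step : ∀ {i G} → Iter D n k i G → (h : E G → S n k) → Iter D n k (suc i) (prod G h)

-- Write an edge-magic labeling of a graph with N vertices and edges as z ↦ 1 + ι z for a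
-- bijection ι onto {0, …, N-1}; if ι has constant edge sum s, the magic sum is 3 + s.  The
-- complementary bijection N-1-ι has edge sum 3(N-1) - s, which differs from s when N is
-- even, so D has two magic sums.  In D_i ⊗_h S_n^k a vertex (a, x) and an edge (e, d) are
-- pairs of an element of D_i and an index j < n (the vertex x, or the position of the label
-- of d among n+1, …, 2n), and the indices along each edge sum to c = k - (n + 3).  Hence
-- n ι + j and ι + N j are again such bijections, with edge sums n s + c and s + N c.  Both
-- maps are strictly increasing in s and the first is the steeper, so i+1 increasing sums of
-- D_i yield i+2 increasing sums of D_{i+1}.
module Submission where

open import Defs
open import Data.Nat using (ℕ; zero; suc; _+_; _*_; _∸_; _≤_; _<_; z≤n; s≤s; s≤s⁻¹)
open import Data.Nat.Properties
open import Data.Nat.Tactic.RingSolver using (solve-∀)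
open import Data.Fin as F using (Fin; toℕ; fromℕ<)
open import Data.Fin.Properties using (toℕ-injective; toℕ<n; toℕ-fromℕ<; toℕ-combine; opposite-prop; *↔×; +↔⊎; ¬Fin0)
open import Data.Fin.Permutation using (↔⇒≡; reverse)
open import Data.Vec.Functional as Vector using (_∷_)
open import Data.Bool using (Bool; true; false; T)
open import Data.Unit using (tt)
open import Data.Sum using (_⊎_; inj₁; inj₂; [_,_]′)
open import Data.Sum.Properties using (inj₂-injective)
open import Data.Sum.Function.Propositional using (_⊎-↔_)
open import Data.Product using (Σ; ∃; _×_; _,_; proj₁; proj₂)
open import Data.Product.Algebra using (×-distribʳ-⊎; ×-comm)
open import Data.Product.Function.NonDependent.Propositional using (_×-↔_)
open import Function using (_∘_; id)
open import Function.Bundles using (_↔_; Inverse; Injection; mk↔ₛ′)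
open import Function.Properties.Inverse using (↔⇒↣)
open import Function.Construct.Composition using (_↔-∘_)
open import Function.Construct.Symmetry using (↔-sym)
open import Function.Construct.Identity using (↔-id)
open import Function.Definitions using (Injective)
open import Relation.Binary.Definitions using (tri<; tri≈; tri>)
open import Relation.Binary.PropositionalEquality
  using (_≡_; _≢_; refl; sym; trans; cong; cong₂; subst; module ≡-Reasoning)
open import Relation.Nullary using (yes; no; contradiction)

open Inverse using (to; from; strictlyInverseˡ; strictlyInverseʳ)

sum-of-sucs : ∀ a b c → suc a + suc b + suc c ≡ 3 + (a + b + c)
sum-of-sucs = solve-∀

complement-sum : ∀ {M a b c} → a ≤ M → b ≤ M → c ≤ M →
  (M ∸ a) + (M ∸ b) + (M ∸ c) ≡ 3 * M ∸ (a + b + c)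
complement-sum {M} {a} {b} {c} a≤M b≤M c≤M = begin
  X                            ≡⟨ sym (m+n∸m≡n (a + b + c) X) ⟩
  (a + b + c) + X ∸ (a + b + c) ≡⟨ cong (_∸ (a + b + c)) total ⟩
  3 * M ∸ (a + b + c)          ∎
  where
  open ≡-Reasoning
  X : ℕ
  X = (M ∸ a) + (M ∸ b) + (M ∸ c)
  regroup : ∀ a b c x y z → (a + b + c) + (x + y + z) ≡ (a + x) + (b + y) + (c + z)
  regroup = solve-∀
  triple : ∀ M → M + M + M ≡ 3 * M
  triple = solve-∀
  total : (a + b + c) + X ≡ 3 * M
  total = begin
    (a + b + c) + X                                       ≡⟨ regroup a b c _ _ _ ⟩
    (a + (M ∸ a)) + (b + (M ∸ b)) + (c + (M ∸ c))          ≡⟨ cong₂ _+_ (cong₂ _+_ (m+[n∸m]≡n a≤M) (m+[n∸m]≡n b≤M)) (m+[n∸m]≡n c≤M) ⟩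
    M + M + M                                             ≡⟨ triple M ⟩
    3 * M                                                 ∎

≢-complement-odd : ∀ s w → s ≢ suc (2 * w) ∸ s
≢-complement-odd s w s≡t∸s with s ≤? suc (2 * w)
... | no s≰t = s≰t (subst (_≤ suc (2 * w)) (sym s≡t∸s) (m∸n≤m _ s))
... | yes s≤t = even≢odd s w (begin
  2 * s                 ≡⟨ cong (s +_) (+-identityʳ s) ⟩
  s + s                 ≡⟨ cong (s +_) s≡t∸s ⟩
  s + (suc (2 * w) ∸ s) ≡⟨ m+[n∸m]≡n s≤t ⟩
  suc (2 * w)           ∎)
  where open ≡-Reasoning

module _ {G : Digraph} where

  magic-pointwise : ∀ {f g : Labeling G} {σ} → (∀ z → f z ≡ g z) → Magic G f σ → Magic G g σ
  magic-pointwise f≗g mag e = trans (sym (cong₂ _+_ (cong₂ _+_ (f≗g _) (f≗g _)) (f≗g _))) (mag e)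

  magic-suc⁺ : ∀ (f : Labeling G) {s} → Magic G f s → Magic G (suc ∘ f) (3 + s)
  magic-suc⁺ _ mag e = trans (sum-of-sucs _ _ _) (cong (3 +_) (mag e))

  magic-suc⁻ : ∀ (f : Labeling G) {σ} → Magic G (suc ∘ f) σ → Magic G f (σ ∸ 3)
  magic-suc⁻ _ mag e = cong (_∸ 3) (trans (sym (sum-of-sucs _ _ _)) (mag e))

  magic-affine : ∀ n (f g : Labeling G) {s c} → Magic G f s → Magic G g c →
    Magic G (λ z → n * f z + g z) (n * s + c)
  magic-affine n _ _ magf magg e = trans (regroup n _ _ _ _ _ _) (cong₂ (λ u v → n * u + v) (magf e) (magg e))
    where
    regroup : ∀ n a b c x y z → (n * a + x) + (n * b + y) + (n * c + z) ≡ n * (a + b + c) + (x + y + z)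
    regroup = solve-∀

  magic-complement : ∀ M (f : Labeling G) {s} → (∀ z → f z ≤ M) → Magic G f s →
    Magic G (λ z → M ∸ f z) (3 * M ∸ s)
  magic-complement M _ f≤M mag e = trans (complement-sum (f≤M _) (f≤M _) (f≤M _)) (cong (3 * M ∸_) (mag e))

label₀ : {A : Set} {N : ℕ} → A ↔ Fin N → A → ℕ
label₀ ι z = toℕ (to ι z)

-- The 0-based form of an edge-magic labeling: adding 1 to every label gives magic sum 3 + s.
Magic₀ : Digraph → ℕ → ℕ → Set
Magic₀ G N s = Σ ((V G ⊎ E G) ↔ Fin N) λ ι → Magic G (label₀ ι) s

interval↔Fin : {A : Set} (f : A → ℕ) (o N : ℕ) →
  (∀ z → o < f z × f z ≤ o + N) → Injective _≡_ _≡_ f →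
  (∀ m → o < m → m ≤ o + N → ∃ λ z → f z ≡ m) →
  Σ (A ↔ Fin N) λ φ → ∀ z → f z ≡ suc (o + label₀ φ z)
interval↔Fin {A} f o N range inj surj = mk↔ₛ′ index pick index-pick pick-index , λ z → sym (index-spec z)
  where
  index-spec′ : ∀ z → suc (o + (f z ∸ suc o)) ≡ f z
  index-spec′ z = m+[n∸m]≡n (proj₁ (range z))
  index< : ∀ z → f z ∸ suc o < N
  index< z = +-cancelˡ-< o _ N (subst (_≤ o + N) (sym (index-spec′ z)) (proj₂ (range z)))
  index : A → Fin N
  index z = fromℕ< (index< z)
  index-spec : ∀ z → suc (o + toℕ (index z)) ≡ f z
  index-spec z = trans (cong (λ t → suc (o + t)) (toℕ-fromℕ< (index< z))) (index-spec′ z)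
  picked : (j : Fin N) → ∃ λ z → f z ≡ suc (o + toℕ j)
  picked j = surj _ (s≤s (m≤m+n o _)) (+-monoʳ-< o (toℕ<n j))
  pick : Fin N → A
  pick j = proj₁ (picked j)
  index-pick : ∀ j → index (pick j) ≡ j
  index-pick j = toℕ-injective (+-cancelˡ-≡ (suc o) _ _ (trans (index-spec (pick j)) (proj₂ (picked j))))
  pick-index : ∀ z → pick (index z) ≡ z
  pick-index z = inj (trans (proj₂ (picked (index z))) (index-spec z))

bijOnto⇒↔ : {A : Set} {f : A → ℕ} {N : ℕ} → BijOnto f N →
  Σ (A ↔ Fin N) λ ι → ∀ z → f z ≡ suc (label₀ ι z)
bijOnto⇒↔ {f = f} {N} (range , inj , surj) = interval↔Fin f 0 N range inj surj

↔⇒bijOnto : {A : Set} {N : ℕ} (ι : A ↔ Fin N) → BijOnto (suc ∘ label₀ ι) N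
↔⇒bijOnto {N = N} ι =
  (λ z → s≤s z≤n , toℕ<n (to ι z)) , (λ eq → Injection.injective (↔⇒↣ ι) (toℕ-injective (suc-injective eq))) , surj
  where
  surj : ∀ m → 1 ≤ m → m ≤ N → ∃ λ z → suc (label₀ ι z) ≡ m
  surj (suc m) _ m<N =
    from ι (fromℕ< m<N) , cong suc (trans (cong toℕ (strictlyInverseˡ ι _)) (toℕ-fromℕ< m<N))

edgeMagic⇒magic₀ : ∀ {G} {f : Labeling G} {N σ} → BijOnto f N → Magic G f σ → Magic₀ G N (σ ∸ 3)
edgeMagic⇒magic₀ {G} bij mag =
  let (ι , f≗) = bijOnto⇒↔ bij in ι , magic-suc⁻ {G} (label₀ ι) (magic-pointwise {G} f≗ mag)

magic₀⇒edgeMagic : ∀ {G P Q s} → HasOrder G P → HasSize G Q → Magic₀ G (P + Q) s →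
  Σ (Labeling G) λ f → IsEdgeMagic G f (3 + s)
magic₀⇒edgeMagic {G} {P} {Q} oG sG (ι , mag) =
  suc ∘ label₀ ι , P , Q , oG , sG , ↔⇒bijOnto ι , magic-suc⁺ {G} (label₀ ι) mag

magic₀-complement : ∀ {G M s} → Magic₀ G (suc M) s → Magic₀ G (suc M) (3 * M ∸ s)
magic₀-complement {G} {M} (ι , mag) =
  reverse ↔-∘ ι ,
  magic-pointwise {G} (λ z → sym (opposite-prop (to ι z)))
    (magic-complement {G} M (label₀ ι) (λ z → s≤s⁻¹ (toℕ<n (to ι z))) mag)

magic₀-combine : ∀ {G M n s c} (Ψ : (V G ⊎ E G) ↔ (Fin M × Fin n)) →
  Magic G (toℕ ∘ proj₁ ∘ to Ψ) s → Magic G (toℕ ∘ proj₂ ∘ to Ψ) c → Magic₀ G (M * n) (n * s + c)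
magic₀-combine {G} {n = n} Ψ mag₁ mag₂ =
  ↔-sym *↔× ↔-∘ Ψ ,
  magic-pointwise {G} (λ z → sym (toℕ-combine (proj₁ (to Ψ z)) (proj₂ (to Ψ z))))
    (magic-affine {G} n (toℕ ∘ proj₁ ∘ to Ψ) (toℕ ∘ proj₂ ∘ to Ψ) mag₁ mag₂)

Increasing : ∀ {m} → (Fin m → ℕ) → Set
Increasing ks = ∀ {a b} → a F.< b → ks a < ks b

record Chain (m : ℕ) (L : ℕ → Set) : Set where
  constructor chain
  field
    terms      : Fin m → ℕ
    increasing : Increasing terms
    satisfied  : ∀ j → L (terms j)

increasing⇒injective : ∀ {m} {ks : Fin m → ℕ} → Increasing ks → Injective _≡_ _≡_ ks
increasing⇒injective inc {a} {b} eq with <-cmp (toℕ a) (toℕ b)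
... | tri< a<b _ _ = contradiction eq (<⇒≢ (inc a<b))
... | tri≈ _ a≡b _ = toℕ-injective a≡b
... | tri> _ _ b<a = contradiction (sym eq) (<⇒≢ (inc b<a))

module _ {L : ℕ → Set} where

  chain-singleton : ∀ {x} → L x → Chain 1 L
  chain-singleton {x} l = chain (λ _ → x) (λ { {F.zero} {F.zero} () }) (λ _ → l)

  chain-cons : ∀ {m x} → L x → (c : Chain (suc m) L) → x < Chain.terms c F.zero → Chain (suc (suc m)) L
  chain-cons {x = x} l (chain ks inc ls) x<k₀ = chain (x ∷ ks) inc′ λ { F.zero → l ; (F.suc j) → ls j }
    where
    k₀≤ : ∀ j → ks F.zero ≤ ks j
    k₀≤ F.zero = ≤-refl
    k₀≤ (F.suc j) = <⇒≤ (inc (s≤s z≤n))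
    inc′ : Increasing (x ∷ ks)
    inc′ {F.zero} {F.suc b} _ = <-≤-trans x<k₀ (k₀≤ b)
    inc′ {F.suc a} {F.suc b} (s≤s a<b) = inc a<b

  chain-tail : ∀ {m} → Chain (suc m) L → Chain m L
  chain-tail (chain ks inc ls) = chain (Vector.tail ks) (λ a<b → inc (s≤s a<b)) (ls ∘ F.suc)

  chain-pair : ∀ {a b} → a ≢ b → L a → L b → Chain 2 L
  chain-pair {a} {b} a≢b la lb with <-cmp a b
  ... | tri< a<b _ _ = chain-cons la (chain-singleton lb) a<b
  ... | tri≈ _ a≡b _ = contradiction a≡b a≢b
  ... | tri> _ _ b<a = chain-cons lb (chain-singleton la) b<a

chain-map : ∀ {L L′ : ℕ → Set} {m} (f : ℕ → ℕ) → (∀ {a b} → a < b → f a < f b) →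
  (∀ {s} → L s → L′ (f s)) → Chain m L → Chain m L′
chain-map f mono lf (chain ks inc ls) = chain (f ∘ ks) (mono ∘ inc) (lf ∘ ls)

steeper⇒mono : (f g : ℕ → ℕ) → (∀ {a b} → a < b → g a < g b) →
  (∀ {a b} → a < b → f a + g b < f b + g a) → ∀ {a b} → a < b → f a < f b
steeper⇒mono f g g-mono steeper {a} {b} a<b =
  +-cancelʳ-< (g b) (f a) (f b) (<-trans (steeper a<b) (+-monoʳ-< (f b) (g-mono a<b)))

-- If f - g is strictly increasing, then at the least term x₀ either f x₀ ≠ g x₀, and the
-- smaller of the two goes in front of the image of the other map, or
-- f x₀ = g x₀ < g x₁ < f x₁ < f x₂ < ….
chain-extend : ∀ {L L′ : ℕ → Set} {m} (f g : ℕ → ℕ) →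
  (∀ {a b} → a < b → g a < g b) → (∀ {a b} → a < b → f a + g b < f b + g a) →
  (∀ {s} → L s → L′ (f s)) → (∀ {s} → L s → L′ (g s)) →
  Chain (suc (suc m)) L → Chain (suc (suc (suc m))) L′
chain-extend {m = m} f g g-mono steeper lf lg c@(chain ks inc ls) with <-cmp (f (ks F.zero)) (g (ks F.zero))
... | tri< lt _ _ = chain-cons (lf (ls F.zero)) (chain-map g g-mono lg c) lt
... | tri> _ _ gt = chain-cons (lg (ls F.zero)) (chain-map f (steeper⇒mono f g g-mono steeper) lf c) gt
... | tri≈ _ eq _ =
  chain-cons (lg (ls F.zero))
    (chain-cons (lg (ls x₁)) (chain-map f (steeper⇒mono f g g-mono steeper) lf (chain-tail c)) g<f)
    (g-mono x₀<x₁)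
  where
  x₁ : Fin (suc (suc m))
  x₁ = F.suc F.zero
  x₀<x₁ : ks F.zero < ks x₁
  x₀<x₁ = inc (s≤s z≤n)
  g<f : g (ks x₁) < f (ks x₁)
  g<f = +-cancelˡ-< (g (ks F.zero)) _ _ (begin-strict
    g (ks F.zero) + g (ks x₁) ≡⟨ cong (_+ g (ks x₁)) eq ⟨
    f (ks F.zero) + g (ks x₁) <⟨ steeper x₀<x₁ ⟩
    f (ks x₁) + g (ks F.zero) ≡⟨ +-comm (f (ks x₁)) _ ⟩
    g (ks F.zero) + f (ks x₁) ∎)
    where open ≤-Reasoning

graphOf : ∀ {n k} → S n k → Digraph
graphOf {n} Γ = digraph (Fin n) (proj₁ Γ)

distinct⇒2≤n : ∀ {n} {x y : Fin n} → x ≢ y → 2 ≤ n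
distinct⇒2≤n {x = F.zero}  {F.zero}  x≢y = contradiction refl x≢y
distinct⇒2≤n {x = F.zero}  {F.suc y} _   = s≤s (≤-trans (s≤s z≤n) (toℕ<n y))
distinct⇒2≤n {x = F.suc x}           _   = s≤s (≤-trans (s≤s z≤n) (toℕ<n x))

oriented-edge⇒2≤n : ∀ {n r} → Oriented (digraph (Fin n) r) → E (digraph (Fin n) r) → 2 ≤ n
oriented-edge⇒2≤n (loopless , _) ((x , y) , t) = distinct⇒2≤n {x = x} {y} λ { refl → subst T (loopless x) t }

-- Vertex x carries label 1 + x, so the edge labels are n+1, …, 2n; the edge labelled n+1+j
-- gets index j.
edgeIndex : ∀ {n k} (Γ : S n k) →
  Σ (E (graphOf Γ) ↔ Fin n) λ w → Magic (graphOf Γ) [ toℕ , label₀ w ]′ (k ∸ (n + 3))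
edgeIndex {n} {k} (r , _ , sz , g , (P , Q , oΓ , sΓ , (range , inj , surj) , _ , mag) , named)
  with ↔⇒≡ oΓ | ↔⇒≡ (sΓ ↔-∘ ↔-sym sz)
... | refl | refl = w , magic
  where
  above : ∀ d → n < g (inj₂ d)
  above d with g (inj₂ d) in eq | proj₁ (range (inj₂ d))
  ... | suc v | _ with v <? n
  ...   | no v≮n = s≤s (≮⇒≥ v≮n)
  ...   | yes v<n = contradiction
    (inj (trans (named (fromℕ< v<n)) (trans (cong suc (toℕ-fromℕ< v<n)) (sym eq)))) λ ()
  onto : ∀ m → n < m → m ≤ n + n → ∃ λ d → g (inj₂ d) ≡ m
  onto m n<m m≤2n with surj m (≤-trans (s≤s z≤n) n<m) m≤2n
  ... | inj₁ x , gx≡m = contradiction (subst (_≤ n) (trans (sym (named x)) gx≡m) (toℕ<n x)) (<⇒≱ n<m)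
  ... | inj₂ d , gd≡m = d , gd≡m
  indexed : Σ (E (digraph (Fin n) r) ↔ Fin n) λ w → ∀ d → g (inj₂ d) ≡ suc (n + label₀ w d)
  indexed = interval↔Fin (g ∘ inj₂) n n (λ d → above d , proj₂ (range (inj₂ d))) (inj₂-injective ∘ inj) onto
  w : E (digraph (Fin n) r) ↔ Fin n
  w = proj₁ indexed
  regroup : ∀ n x j y → (x + j + y) + (n + 3) ≡ suc x + suc (n + j) + suc y
  regroup = solve-∀
  magic : Magic (digraph (Fin n) r) [ toℕ , label₀ w ]′ (k ∸ (n + 3))
  magic d@((x , y) , _) = begin
    toℕ x + label₀ w d + toℕ y                                ≡⟨ m+n∸n≡m _ (n + 3) ⟨
    (toℕ x + label₀ w d + toℕ y) + (n + 3) ∸ (n + 3)          ≡⟨ cong (_∸ (n + 3)) (regroup n _ _ _) ⟩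
    (suc (toℕ x) + suc (n + label₀ w d) + suc (toℕ y)) ∸ (n + 3)
      ≡⟨ cong (_∸ (n + 3)) (trans labels (mag d)) ⟩
    k ∸ (n + 3)                                               ∎
    where
    open ≡-Reasoning
    labels : suc (toℕ x) + suc (n + label₀ w d) + suc (toℕ y) ≡ g (inj₁ x) + g (inj₂ d) + g (inj₁ y)
    labels = sym (cong₂ _+_ (cong₂ _+_ (named x) (proj₂ indexed d)) (named y))

T-sel↔ : ∀ b (g : T b → Bool) → T (sel b g) ↔ Σ (T b) (T ∘ g)
T-sel↔ true  g = mk↔ₛ′ (tt ,_) proj₂ (λ _ → refl) (λ _ → refl)
T-sel↔ false g = mk↔ₛ′ (λ ()) (λ { (() , _) }) (λ { (() , _) }) (λ ())

Σ↔× : {A C : Set} {B : A → Set} → (∀ a → B a ↔ C) → Σ A B ↔ (A × C)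
Σ↔× w = mk↔ₛ′ (λ (a , b) → a , to (w a) b) (λ (a , c) → a , from (w a) c)
  (λ (a , c) → cong (a ,_) (strictlyInverseˡ (w a) c)) (λ (a , b) → cong (a ,_) (strictlyInverseʳ (w a) b))

module Product (G : Digraph) {n k : ℕ} (h : E G → S n k) where

  edges↔ : E (prod G h) ↔ Σ (E G) (λ e → E (graphOf (h e)))
  edges↔ = mk↔ₛ′ split join split-join join-split
    where
    arcs : ∀ a b x y → T (sel (arc G a b) (λ t → proj₁ (h ((a , b) , t)) x y)) ↔
                       Σ (T (arc G a b)) (λ t → T (proj₁ (h ((a , b) , t)) x y))
    arcs a b x y = T-sel↔ (arc G a b) _
    split : E (prod G h) → Σ (E G) (λ e → E (graphOf (h e)))
    split (((a , x) , (b , y)) , t) = let (t₁ , t₂) = to (arcs a b x y) t in ((a , b) , t₁) , ((x , y) , t₂)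
    join : Σ (E G) (λ e → E (graphOf (h e))) → E (prod G h)
    join (((a , b) , t₁) , ((x , y) , t₂)) = ((a , x) , (b , y)) , from (arcs a b x y) (t₁ , t₂)
    split-join : ∀ p → split (join p) ≡ p
    split-join (((a , b) , t₁) , ((x , y) , t₂)) =
      cong (λ (t₁ , t₂) → ((a , b) , t₁) , ((x , y) , t₂)) (strictlyInverseˡ (arcs a b x y) (t₁ , t₂))
    join-split : ∀ ε → join (split ε) ≡ ε
    join-split (((a , x) , (b , y)) , t) = cong (((a , x) , (b , y)) ,_) (strictlyInverseʳ (arcs a b x y) t)

  edges↔× : E (prod G h) ↔ (E G × Fin n)
  edges↔× = Σ↔× (λ e → proj₁ (edgeIndex (h e))) ↔-∘ edges↔

  elements↔ : (V (prod G h) ⊎ E (prod G h)) ↔ ((V G ⊎ E G) × Fin n)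
  elements↔ = ↔-sym (×-distribʳ-⊎ _ (Fin n) (V G) (E G)) ↔-∘ (↔-id _ ⊎-↔ edges↔×)

  prod-order : ∀ {P} → HasOrder G P → HasOrder (prod G h) (P * n)
  prod-order oG = ↔-sym *↔× ↔-∘ (oG ×-↔ ↔-id _)

  prod-size : ∀ {Q} → HasSize G Q → HasSize (prod G h) (Q * n)
  prod-size sG = ↔-sym *↔× ↔-∘ ((sG ×-↔ ↔-id _) ↔-∘ edges↔×)

  edge⇒2≤n : E (prod G h) → 2 ≤ n
  edge⇒2≤n ε = let (e , d) = to edges↔ ε in oriented-edge⇒2≤n (proj₁ (proj₂ (h e))) d

  prod-magic₀ : ∀ {N s} → Magic₀ G N s →
    Magic₀ (prod G h) (N * n) (n * s + (k ∸ (n + 3))) × Magic₀ (prod G h) (n * N) (N * (k ∸ (n + 3)) + s)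
  prod-magic₀ {N} {s} (ι , mag) =
    magic₀-combine {prod G h} Ψ mag₁ mag₂ , magic₀-combine {prod G h} (×-comm _ _ ↔-∘ Ψ) mag₂ mag₁
    where
    Ψ : (V (prod G h) ⊎ E (prod G h)) ↔ (Fin N × Fin n)
    Ψ = (ι ×-↔ ↔-id _) ↔-∘ elements↔
    mag₁ : Magic (prod G h) (toℕ ∘ proj₁ ∘ to Ψ) s
    mag₁ ε@(((a , x) , (b , y)) , _) = mag (proj₁ (to edges↔ ε))
    mag₂ : Magic (prod G h) (toℕ ∘ proj₂ ∘ to Ψ) (k ∸ (n + 3))
    mag₂ ε@(((a , x) , (b , y)) , _) = let (e , d) = to edges↔ ε in proj₂ (edgeIndex (h e)) d

record MagicSums (i : ℕ) (G : Digraph) : Set where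
  field
    order size : ℕ
    hasOrder   : HasOrder G order
    hasSize    : HasSize G size
    sums       : Chain (suc i) (Magic₀ G (order + size))

edgelessSums : ∀ {i G P} → HasOrder G P → HasSize G 0 → MagicSums i G
edgelessSums {P = P} oG sG = record
  { order = P ; size = 0 ; hasOrder = oG ; hasSize = sG
  ; sums = chain toℕ id λ _ → ↔-sym +↔⊎ ↔-∘ (oG ⊎-↔ sG) , λ e → contradiction (to sG e) ¬Fin0 }

sumsIfEdge : ∀ {i G P Q} → HasOrder G P → HasSize G Q →
  (E G → Chain (suc i) (Magic₀ G (P + Q))) → MagicSums i G
sumsIfEdge {Q = zero}  oG sG _    = edgelessSums oG sG
sumsIfEdge {Q = suc _} oG sG grow = record { hasOrder = oG ; hasSize = sG ; sums = grow (from sG F.zero) }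

complementaryPair : ∀ {G m s} → Magic₀ G (suc m + suc m) s → Chain 2 (Magic₀ G (suc m + suc m))
complementaryPair {m = m} {s} L =
  chain-pair (subst (λ t → s ≢ t ∸ s) (odd m) (≢-complement-odd s (3 * m + 1))) L (magic₀-complement L)
  where
  odd : ∀ m → suc (2 * (3 * m + 1)) ≡ 3 * (m + suc m)
  odd = solve-∀

baseSums : ∀ {p k₀ r} → NamedSEM p p k₀ r → MagicSums 1 (digraph (Fin p) r)
baseSums {zero} (_ , sz , _) = edgelessSums (↔-id _) sz
baseSums {suc m} (_ , sz , f , (P , Q , oD , sD , bij , _ , mag) , _)
  with ↔⇒≡ oD | ↔⇒≡ (sD ↔-∘ ↔-sym sz)
... | refl | refl =
  record { hasOrder = oD ; hasSize = sD ; sums = complementaryPair (edgeMagic⇒magic₀ bij mag) }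

affine-steeper : ∀ {n} c d → 2 ≤ n → ∀ {a b} → a < b → (n * a + c) + (d + b) < (n * b + c) + (d + a)
affine-steeper {suc (suc n₂)} c d (s≤s (s≤s z≤n)) {a} {b} a<b = begin-strict
  (suc (suc n₂) * a + c) + (d + b)  ≡⟨ regroupˡ n₂ a b c d ⟩
  suc n₂ * a + (a + b + c + d)      <⟨ +-monoˡ-< _ (*-monoʳ-< (suc n₂) a<b) ⟩
  suc n₂ * b + (a + b + c + d)      ≡⟨ regroupʳ n₂ a b c d ⟨
  (suc (suc n₂) * b + c) + (d + a)  ∎
  where
  open ≤-Reasoning
  regroupˡ : ∀ n₂ a b c d → (suc (suc n₂) * a + c) + (d + b) ≡ suc n₂ * a + (a + b + c + d)
  regroupˡ = solve-∀
  regroupʳ : ∀ n₂ a b c d → (suc (suc n₂) * b + c) + (d + a) ≡ suc n₂ * b + (a + b + c + d)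
  regroupʳ = solve-∀

stepSums : ∀ {i G n k} → MagicSums (suc i) G → (h : E G → S n k) → MagicSums (suc (suc i)) (prod G h)
stepSums {i} {G} {n} {k} sums₀ h = sumsIfEdge (prod-order hasOrder) (prod-size hasSize) grow
  where
  open MagicSums sums₀
  open Product G h
  N c : ℕ
  N = order + size
  c = k ∸ (n + 3)
  grow : E (prod G h) → Chain (3 + i) (Magic₀ (prod G h) (order * n + size * n))
  grow ε = chain-extend (λ s → n * s + c) (λ s → N * c + s)
    (+-monoʳ-< (N * c)) (affine-steeper c (N * c) (edge⇒2≤n ε))
    (λ {s} L → subst (λ M → Magic₀ (prod G h) M (n * s + c)) (*-distribʳ-+ n order size) (proj₁ (prod-magic₀ L)))
    (λ {s} L → subst (λ M → Magic₀ (prod G h) M (N * c + s)) (trans (*-comm n N) (*-distribʳ-+ n order size))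
      (proj₂ (prod-magic₀ L)))
    sums

iterSums : ∀ {p k₀ r n k i G} → NamedSEM p p k₀ r → Iter (digraph (Fin p) r) n k i G → MagicSums i G
iterSums D base = baseSums D
iterSums D (step {zero} () h)
iterSums D (step {suc i} it h) = stepSums (iterSums D it) h

theorem4p4 : (p n k : ℕ) (r : Fin p → Fin p → Bool) →
    (∃ λ k₀ → NamedSEM p p k₀ r) →
    ∀ i G → Iter (digraph (Fin p) r) n k i G →
    Σ (Fin (suc i) → ℕ) λ ks → Injective _≡_ _≡_ ks
    × (∀ j → Σ (Labeling G) λ f → IsEdgeMagic G f (ks j))
theorem4p4 p n k r (k₀ , D) i G it =
  (λ j → 3 + terms j) ,
  (λ eq → increasing⇒injective increasing (+-cancelˡ-≡ 3 _ _ eq)) ,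
  (λ j → magic₀⇒edgeMagic hasOrder hasSize (satisfied j))
  where
  open MagicSums (iterSums D it)
  open Chain sums
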